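{- For any altered Wythoff game there exists a natural column $t$ such that $t$ and every column $t'\ge t$ are saturated, i.e. for every $t'\ge t$ and every integer $y\ge0$, $\mathrm{diag}_{t'}[y]$ is TRUE if and only if $\ell_{t'}\le y\le u_{t'}$.
   Context: Wythoff's game: a position is a pair $(x,y)$ of non-negative integers ($x$ = column, $y$ = row). A move from $(x,y)$ goes to $(x-k,y)$, $(x,y-k)$ or $(x-k,y-k)$ for some integer $k\ge1$, with non-negative result. An altered Wythoff game is given by finite disjoint sets $\mathcal{P},\mathcal{N}\subset\mathbb{Z}_{\ge0}^2$; positions are labelled by recursion on $x+y$: positions in $\mathcal{P}$ are P, positions in $\mathcal{N}$ are N, any other position is P if no position reachable in one move is labelled P, and N otherwise. Fix $m_x$ such that every element of $\mathcal{P}\cup\mathcal{N}$ has first coordinate $<m_x$; a column $t$ is natural if $t\ge m_x$. For a column $t$ and integer $y\ge0$: $\mathrm{diag}_t[y]$ is TRUE iff the diagonal $\{(t-k,y-k):k\ge0\}$ contains a P-position. $\ell_t$ is the minimum and $u_t$ the maximum $y$ with $\mathrm{diag}_t[y]$ TRUE. -}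

module Defs where

open import Data.Nat using (ℕ; zero; suc; _∸_; _⊓_; _≤_; _<_; _≡ᵇ_; _+_)
open import Data.Bool using (Bool; true; false; _∨_; _∧_; not; if_then_else_)
open import Data.Product using (_×_; _,_; proj₁; proj₂; ∃; ∃-syntax)
open import Data.List using (List)
open import Data.Bool.ListAction using (any)
open import Data.List.Membership.Propositional using (_∈_)
open import Data.Empty using (⊥)
open import Relation.Binary.PropositionalEquality using (_≡_)
open import Function.Bundles using (_⇔_)

-- An altered Wythoff game: finite disjoint sets 𝒫, 𝒩 of positions (x , y),
-- x = column, y = row, given as finite lists.
record AlteredWythoff : Set where
  field
    Pset     : List (ℕ × ℕ)
    Nset     : List (ℕ × ℕ)
    disjoint : ∀ p → p ∈ Pset → p ∈ Nset → ⊥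

open AlteredWythoff public

memb : ℕ → ℕ → List (ℕ × ℕ) → Bool
memb x y = any (λ p → (proj₁ p ≡ᵇ x) ∧ (proj₂ p ≡ᵇ y))

someK : ℕ → (ℕ → Bool) → Bool
someK zero    f = false
someK (suc n) f = f (suc n) ∨ someK n f

-- Labelling with fuel: labF (suc (x + y)) x y is the correct label
-- (true = P, false = N); the recursion is on x + y, every option of (x , y)
-- has strictly smaller coordinate sum, so fuel x + y suffices for them.
labF : AlteredWythoff → ℕ → ℕ → ℕ → Bool
labF G zero    x y = false
labF G (suc n) x y =
  if memb x y (Pset G) then true
  else if memb x y (Nset G) then false
  else not ( someK x (λ k → labF G n (x ∸ k) y)
           ∨ someK y (λ k → labF G n x (y ∸ k))
           ∨ someK (x ⊓ y) (λ k → labF G n (x ∸ k) (y ∸ k)))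

isP : AlteredWythoff → ℕ → ℕ → Bool
isP G x y = labF G (suc (x + y)) x y

BoundsColumns : AlteredWythoff → ℕ → Set
BoundsColumns G mx =
  (∀ p → p ∈ Pset G → proj₁ p < mx) × (∀ p → p ∈ Nset G → proj₁ p < mx)

Diag : AlteredWythoff → ℕ → ℕ → Set
Diag G t y = ∃[ k ] (k ≤ t × k ≤ y × isP G (t ∸ k) (y ∸ k) ≡ true)

IsLeastDiag : AlteredWythoff → ℕ → ℕ → Set
IsLeastDiag G t ℓ = Diag G t ℓ × (∀ y → Diag G t y → ℓ ≤ y)

IsGreatestDiag : AlteredWythoff → ℕ → ℕ → Set
IsGreatestDiag G t u = Diag G t u × (∀ y → Diag G t y → y ≤ u)

Saturated : AlteredWythoff → ℕ → Set
Saturated G t =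
  ∃[ ℓ ] ∃[ u ] (IsLeastDiag G t ℓ × IsGreatestDiag G t u ×
                 (∀ y → Diag G t y ⇔ (ℓ ≤ y × y ≤ u)))

-- In a natural column t + 1 nothing is altered, so it holds exactly one P-position, at the
-- least row p that carries no P-position of an earlier column and where diag_t[p − 1] fails.
-- Hence diag_{t+1} is diag_t shifted up by one row plus the row p, and
-- ℓ_{t+1} = min(ℓ_t + 1, p), u_{t+1} = max(u_t + 1, p).  Once every row below ℓ_t is taken and
-- every row above u_t is free (which happens after finitely many columns, as u_t grows), a hole
-- of diag_{t+1} between its extremes continues the diagonal of a hole of diag_t: holes never
-- appear, so a gapless column stays gapless, i.e. saturated.  Counted along their diagonals,
-- the holes never increase and drop whenever p − 1 is a hole.  If that never happened while a
-- hole persists, p would always be ℓ_t or u_t + 2; such P-positions at u_t + 2 are two rows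
-- apart, yet the rows just above the hole diagonal force two of them into adjacent rows.

module Submission where

open import Defs
open import Data.Nat
open import Data.Nat.Properties
open import Data.Bool using (Bool; true; false; _∨_; not; if_then_else_; T)
open import Data.Bool.Properties
  using (∨-zeroʳ; ∨-identityʳ; ∨-conicalˡ; ∨-conicalʳ; not-injective; not-¬; ¬-not; T-∧)
  renaming (_≟_ to _≟ᵇ_)
open import Data.Product
open import Data.Sum using (_⊎_; inj₁; inj₂)
open import Data.List using (List; []; _∷_)
open import Data.List.Membership.Propositional using (_∈_; find)
open import Data.List.Relation.Unary.Any using (here; there)
open import Data.List.Relation.Unary.Any.Properties using (any⁻)
open import Data.Empty using (⊥; ⊥-elim)
open import Function using (case_of_)
open import Function.Bundles using (Equivalence; _⇔_; mk⇔)
open import Relation.Binary using (tri<; tri≈; tri>)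
open import Relation.Binary.PropositionalEquality
open import Relation.Nullary using (¬_; yes; no)
open import Relation.Nullary.Decidable using (_×-dec_)
open import Relation.Unary using (Decidable)

∨-true⁻ : ∀ a {b} → a ∨ b ≡ true → a ≡ true ⊎ b ≡ true
∨-true⁻ true  _ = inj₁ refl
∨-true⁻ false e = inj₂ e

∨-trueˡ : ∀ {a} b → a ≡ true → a ∨ b ≡ true
∨-trueˡ _ refl = refl

∨-trueʳ : ∀ a {b} → b ≡ true → a ∨ b ≡ true
∨-trueʳ a refl = ∨-zeroʳ a

not-∨₃-true⁻ : ∀ a b c → not (a ∨ b ∨ c) ≡ true → a ≡ false × b ≡ false × c ≡ false
not-∨₃-true⁻ a b c e =
  ∨-conicalˡ a _ a∨b∨c , ∨-conicalˡ b c (∨-conicalʳ a _ a∨b∨c) , ∨-conicalʳ b c (∨-conicalʳ a _ a∨b∨c)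
  where a∨b∨c = not-injective {y = false} e

≡true-ext : ∀ {a b} → (a ≡ true → b ≡ true) → (b ≡ true → a ≡ true) → a ≡ b
≡true-ext {true}          f _ = sym (f refl)
≡true-ext {false} {false} _ _ = refl
≡true-ext {false} {true}  _ g = g refl

someK-true⁻ : ∀ n f → someK n f ≡ true → ∃[ k ] (0 < k × k ≤ n × f k ≡ true)
someK-true⁻ (suc n) f e with f (suc n) in fn
... | true  = suc n , s≤s z≤n , ≤-refl , fn
... | false with someK-true⁻ n f e
...   | k , 0<k , k≤n , fk = k , 0<k , m≤n⇒m≤1+n k≤n , fk

someK-true⁺ : ∀ n f {k} → 0 < k → k ≤ n → f k ≡ true → someK n f ≡ true
someK-true⁺ zero    f (s≤s _) ()
someK-true⁺ (suc n) f 0<k k≤1+n fk with m≤n⇒m<n∨m≡n k≤1+n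
... | inj₂ refl = ∨-trueˡ _ fk
... | inj₁ k<1+n = ∨-trueʳ (f (suc n)) (someK-true⁺ n f 0<k (≤-pred k<1+n) fk)

someK-false : ∀ n f → (∀ k → 0 < k → k ≤ n → f k ≡ false) → someK n f ≡ false
someK-false n f none = ¬-not λ e →
  let k , 0<k , k≤n , fk = someK-true⁻ n f e in not-¬ fk (none k 0<k k≤n)

someK-cong : ∀ n f g → (∀ k → 0 < k → k ≤ n → f k ≡ g k) → someK n f ≡ someK n g
someK-cong n f g f≗g = ≡true-ext
  (λ e → let k , 0<k , k≤n , fk = someK-true⁻ n f e in
    someK-true⁺ n g 0<k k≤n (trans (sym (f≗g k 0<k k≤n)) fk))
  (λ e → let k , 0<k , k≤n , gk = someK-true⁻ n g e in
    someK-true⁺ n f 0<k k≤n (trans (f≗g k 0<k k≤n) gk))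

anyUpTo : ℕ → (ℕ → Bool) → Bool
anyUpTo zero    f = f 0
anyUpTo (suc n) f = f 0 ∨ anyUpTo n (λ k → f (suc k))

anyUpTo-true⁻ : ∀ n f → anyUpTo n f ≡ true → ∃[ k ] (k ≤ n × f k ≡ true)
anyUpTo-true⁻ zero    f e = 0 , z≤n , e
anyUpTo-true⁻ (suc n) f e with ∨-true⁻ (f 0) e
... | inj₁ f0 = 0 , z≤n , f0
... | inj₂ e′ = let k , k≤n , fk = anyUpTo-true⁻ n (λ k → f (suc k)) e′ in suc k , s≤s k≤n , fk

anyUpTo-true⁺ : ∀ n f {k} → k ≤ n → f k ≡ true → anyUpTo n f ≡ true
anyUpTo-true⁺ zero    f z≤n       fk = fk
anyUpTo-true⁺ (suc n) f {zero}  _ fk = ∨-trueˡ _ fk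
anyUpTo-true⁺ (suc n) f {suc k} (s≤s k≤n) fk = ∨-trueʳ (f 0) (anyUpTo-true⁺ n (λ k → f (suc k)) k≤n fk)

someK-suc : ∀ n f → someK (suc n) f ≡ anyUpTo n (λ k → f (suc k))
someK-suc n f = ≡true-ext
  (λ e → shift (someK-true⁻ (suc n) f e))
  (λ e → let k , k≤n , fk = anyUpTo-true⁻ n _ e in someK-true⁺ (suc n) f (s≤s z≤n) (s≤s k≤n) fk)
  where
  shift : ∃[ k ] (0 < k × k ≤ suc n × f k ≡ true) → anyUpTo n (λ k → f (suc k)) ≡ true
  shift (suc k , _ , s≤s k≤n , fk) = anyUpTo-true⁺ n _ k≤n fk

module _ {P : ℕ → Set} (P? : Decidable P) where

  search≤ : ∀ n → ∃[ k ] (k ≤ n × P k) ⊎ (∀ k → k ≤ n → ¬ P k)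
  search≤ zero with P? 0
  ... | yes p0 = inj₁ (0 , z≤n , p0)
  ... | no ¬p0 = inj₂ λ { .0 z≤n → ¬p0 }
  search≤ (suc n) with P? (suc n) | search≤ n
  ... | yes pn | _                  = inj₁ (suc n , ≤-refl , pn)
  ... | no _   | inj₁ (k , k≤n , pk) = inj₁ (k , m≤n⇒m≤1+n k≤n , pk)
  ... | no ¬pn | inj₂ none          = inj₂ λ k k≤1+n → case m≤n⇒m<n∨m≡n k≤1+n of λ where
    (inj₁ k<1+n) → none k (≤-pred k<1+n)
    (inj₂ refl)  → ¬pn

  least : ∀ n → ∃[ k ] (k ≤ n × P k) → ∃[ ℓ ] (P ℓ × (∀ y → P y → ℓ ≤ y))
  least zero    (.0 , z≤n , p0) = 0 , p0 , λ _ _ → z≤n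
  least (suc n) (k , k≤1+n , pk) with search≤ n
  ... | inj₁ smaller = least n smaller
  ... | inj₂ none    = k , pk , λ y py → ≤-trans k≤1+n (≰⇒> λ y≤n → none y y≤n py)

  greatest : ∀ n → ∃[ k ] (k ≤ n × P k) → (∀ y → P y → y ≤ n) → ∃[ u ] (P u × (∀ y → P y → y ≤ u))
  greatest zero    (.0 , z≤n , p0) bounded = 0 , p0 , bounded
  greatest (suc n) (k , k≤1+n , pk) bounded with P? (suc n)
  ... | yes pn = suc n , pn , bounded
  ... | no ¬pn = greatest n (k , below k≤1+n pk , pk) λ y py → below (bounded y py) py
    where
    below : ∀ {y} → y ≤ suc n → P y → y ≤ n
    below {y} y≤1+n py = ≤-pred (≤∧≢⇒< y≤1+n λ { refl → ¬pn py })

sumBelow : ℕ → (ℕ → ℕ) → ℕ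
sumBelow zero    f = 0
sumBelow (suc n) f = f n + sumBelow n f

sumBelow-mono : ∀ n f g → (∀ k → k < n → f k ≤ g k) → sumBelow n f ≤ sumBelow n g
sumBelow-mono zero    f g f≤g = z≤n
sumBelow-mono (suc n) f g f≤g =
  +-mono-≤ (f≤g n (n<1+n n)) (sumBelow-mono n f g λ k k<n → f≤g k (m<n⇒m<1+n k<n))

sumBelow-mono-< : ∀ n f g → (∀ k → k < n → f k ≤ g k) → ∀ k₀ → k₀ < n → f k₀ < g k₀ →
                  sumBelow n f < sumBelow n g
sumBelow-mono-< (suc n) f g f≤g k₀ k₀<1+n fk₀<gk₀ with m≤n⇒m<n∨m≡n (≤-pred k₀<1+n)
... | inj₂ refl = +-mono-<-≤ fk₀<gk₀ (sumBelow-mono n f g λ k k<n → f≤g k (m<n⇒m<1+n k<n))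
... | inj₁ k₀<n = +-mono-≤-< (f≤g n (n<1+n n))
                    (sumBelow-mono-< n f g (λ k k<n → f≤g k (m<n⇒m<1+n k<n)) k₀ k₀<n fk₀<gk₀)

above-⊓ : ∀ {ℓ p z} → suc ℓ ⊓ p ≤ z → ℓ ≤ p → z ≢ p → ℓ < z
above-⊓ {ℓ} {p} {z} ℓ⊓p≤z ℓ≤p z≢p with ⊓-sel (suc ℓ) p
... | inj₁ ≡1+ℓ = subst (_≤ z) ≡1+ℓ ℓ⊓p≤z
... | inj₂ ≡p   = ≤-<-trans ℓ≤p (≤∧≢⇒< (subst (_≤ z) ≡p ℓ⊓p≤z) (λ p≡z → z≢p (sym p≡z)))

below-⊔ : ∀ {u p z} → z ≤ suc u ⊔ p → p ≤ suc (suc u) → z ≢ p → z ≤ suc u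
below-⊔ {u} {p} {z} z≤u⊔p p≤2+u z≢p with ⊔-sel (suc u) p
... | inj₁ ≡1+u = subst (z ≤_) ≡1+u z≤u⊔p
... | inj₂ ≡p   = ≤-pred (≤-trans (≤∧≢⇒< (subst (z ≤_) ≡p z≤u⊔p) z≢p) p≤2+u)

memb-true⁻ : ∀ {x y} L → memb x y L ≡ true → ∃[ p ] (p ∈ L × proj₁ p ≡ x × proj₂ p ≡ y)
memb-true⁻ L e with find (any⁻ _ L (subst T (sym e) _))
... | p , p∈L , match = let px , py = Equivalence.to T-∧ match in
  p , p∈L , ≡ᵇ⇒≡ _ _ px , ≡ᵇ⇒≡ _ _ py

rowBound : List (ℕ × ℕ) → ℕ
rowBound []       = 0
rowBound (p ∷ ps) = suc (proj₂ p) ⊔ rowBound ps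

rowBound-sound : ∀ {p} L → p ∈ L → proj₂ p < rowBound L
rowBound-sound (q ∷ L) (here refl) = m≤m⊔n _ (rowBound L)
rowBound-sound (q ∷ L) (there p∈L) = ≤-trans (rowBound-sound L p∈L) (m≤n⊔m (suc (proj₂ q)) _)

module Labelling (G : AlteredWythoff) where

  optionsBy : (ℕ → ℕ → Bool) → ℕ → ℕ → Bool
  optionsBy f x y = someK x (λ k → f (x ∸ k) y) ∨ someK y (λ k → f x (y ∸ k))
                    ∨ someK (x ⊓ y) (λ k → f (x ∸ k) (y ∸ k))

  optionsBy-cong : ∀ f g x y → (∀ x′ y′ → x′ + y′ < x + y → f x′ y′ ≡ g x′ y′) →
                   optionsBy f x y ≡ optionsBy g x y
  optionsBy-cong f g x y f≗g =
    cong₂ _∨_ (someK-cong x _ _ λ k 0<k k≤x → f≗g _ _ (+-monoˡ-< y (∸-monoʳ-< 0<k k≤x)))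
     (cong₂ _∨_ (someK-cong y _ _ λ k 0<k k≤y → f≗g _ _ (+-monoʳ-< x (∸-monoʳ-< 0<k k≤y)))
                (someK-cong (x ⊓ y) _ _ λ k 0<k k≤x⊓y → f≗g _ _
                  (+-mono-<-≤ (∸-monoʳ-< 0<k (≤-trans k≤x⊓y (m⊓n≤m x y))) (m∸n≤m y k))))

  Unaltered : ℕ → ℕ → Set
  Unaltered x y = memb x y (Pset G) ≡ false × memb x y (Nset G) ≡ false

  labF-stable : ∀ n m x y → x + y < n → x + y < m → labF G n x y ≡ labF G m x y
  labF-stable (suc n) (suc m) x y (s≤s x+y≤n) (s≤s x+y≤m) =
    cong (λ b → if memb x y (Pset G) then true else if memb x y (Nset G) then false else not b)
      (optionsBy-cong _ _ x y λ x′ y′ lt →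
        labF-stable n m x′ y′ (<-≤-trans lt x+y≤n) (<-≤-trans lt x+y≤m))

  -- Abstract only for checking speed: conversion checks must not unfold the fuelled recursion.
  abstract
    label : ℕ → ℕ → Bool
    label = isP G

    label≡isP : ∀ x y → label x y ≡ isP G x y
    label≡isP x y = refl

    label-unaltered : ∀ x y → Unaltered x y → label x y ≡ not (optionsBy label x y)
    label-unaltered x y (∉P , ∉N) rewrite ∉P | ∉N =
      cong not (optionsBy-cong _ _ x y λ x′ y′ lt → labF-stable _ _ x′ y′ lt (n<1+n _))

module Positions (G : AlteredWythoff) (mx : ℕ) (bounds : BoundsColumns G mx) where

  open Labelling G public

  my : ℕ
  my = rowBound (Pset G) ⊔ rowBound (Nset G)

  unaltered-column : ∀ x y → mx ≤ x → Unaltered x y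
  unaltered-column x y mx≤x = avoid (proj₁ bounds) , avoid (proj₂ bounds)
    where
    avoid : ∀ {L} → (∀ p → p ∈ L → proj₁ p < mx) → memb x y L ≡ false
    avoid {L} bound = ¬-not λ e → let p , p∈L , px , _ = memb-true⁻ L e in
      <⇒≱ (subst (_< mx) px (bound p p∈L)) mx≤x

  unaltered-row : ∀ x y → my ≤ y → Unaltered x y
  unaltered-row x y my≤y = avoid (Pset G) (m≤m⊔n _ _) , avoid (Nset G) (m≤n⊔m _ _)
    where
    avoid : ∀ L → rowBound L ≤ my → memb x y L ≡ false
    avoid L bound = ¬-not λ e → let p , p∈L , _ , py = memb-true⁻ L e in
      <⇒≱ (≤-trans (subst (_< rowBound L) py (rowBound-sound L p∈L)) bound) my≤y

  rowP : ℕ → ℕ → Bool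
  rowP t y = anyUpTo t (λ k → label (t ∸ k) y)

  columnBelow : ℕ → ℕ → Bool
  columnBelow x y = someK y (λ k → label x (y ∸ k))

  diag : ℕ → ℕ → Bool
  diag t y = anyUpTo (t ⊓ y) (λ k → label (t ∸ k) (y ∸ k))

  diagBelow : ℕ → ℕ → Bool
  diagBelow t zero    = false
  diagBelow t (suc y) = diag t y

  rowP-true⁻ : ∀ t y → rowP t y ≡ true → ∃[ c ] (c ≤ t × label c y ≡ true)
  rowP-true⁻ zero    y e = 0 , z≤n , e
  rowP-true⁻ (suc t) y e with ∨-true⁻ (label (suc t) y) e
  ... | inj₁ p = suc t , ≤-refl , p
  ... | inj₂ e′ = let c , c≤t , p = rowP-true⁻ t y e′ in c , m≤n⇒m≤1+n c≤t , p

  rowP-true⁺ : ∀ t y {c} → c ≤ t → label c y ≡ true → rowP t y ≡ true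
  rowP-true⁺ zero    y z≤n p = p
  rowP-true⁺ (suc t) y c≤1+t p with m≤n⇒m<n∨m≡n c≤1+t
  ... | inj₂ refl  = ∨-trueˡ _ p
  ... | inj₁ c<1+t = ∨-trueʳ (label (suc t) y) (rowP-true⁺ t y (≤-pred c<1+t) p)

  columnBelow-true⁻ : ∀ x y → columnBelow x y ≡ true → ∃[ y′ ] (y′ < y × label x y′ ≡ true)
  columnBelow-true⁻ x y e = let k , 0<k , k≤y , p = someK-true⁻ y _ e in y ∸ k , ∸-monoʳ-< 0<k k≤y , p

  columnBelow-true⁺ : ∀ x {y y′} → y′ < y → label x y′ ≡ true → columnBelow x y ≡ true
  columnBelow-true⁺ x {y} {y′} y′<y p = someK-true⁺ y _ (m<n⇒0<n∸m y′<y) (m∸n≤m y y′)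
    (subst (λ z → label x z ≡ true) (sym (m∸[m∸n]≡n (<⇒≤ y′<y))) p)

  diag-suc : ∀ t y → diag (suc t) y ≡ label (suc t) y ∨ diagBelow t y
  diag-suc t zero    = sym (∨-identityʳ _)
  diag-suc t (suc y) = refl

  Diag⇔diag : ∀ t y → Diag G t y ⇔ (diag t y ≡ true)
  Diag⇔diag t y = mk⇔
    (λ (k , k≤t , k≤y , p) → anyUpTo-true⁺ (t ⊓ y) _ (⊓-glb k≤t k≤y) (trans (label≡isP _ _) p))
    (λ e → let k , k≤t⊓y , p = anyUpTo-true⁻ (t ⊓ y) _ e in
      k , ≤-trans k≤t⊓y (m⊓n≤m t y) , ≤-trans k≤t⊓y (m⊓n≤n t y) , trans (sym (label≡isP _ _)) p)

  label-natural : ∀ t y → mx ≤ suc t →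
                  label (suc t) y ≡ not (rowP t y ∨ columnBelow (suc t) y ∨ diagBelow t y)
  label-natural t y nat = trans (label-unaltered (suc t) y (unaltered-column (suc t) y nat))
    (cong not (cong₂ _∨_ (someK-suc t (λ k → label (suc t ∸ k) y))
                            (cong (columnBelow (suc t) y ∨_) (diagonal y))))
    where
    diagonal : ∀ y → someK (suc t ⊓ y) (λ k → label (suc t ∸ k) (y ∸ k)) ≡ diagBelow t y
    diagonal zero    = refl
    diagonal (suc z) = someK-suc (t ⊓ z) (λ k → label (suc t ∸ k) (suc z ∸ k))

  columnBelow-high-P : ∀ x y → my ≤ y → label x y ≡ true → columnBelow x y ≡ false
  columnBelow-high-P x y my≤y p = proj₁ (proj₂ (not-∨₃-true⁻ (someK x (λ k → label (x ∸ k) y))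
    (columnBelow x y) (someK (x ⊓ y) (λ k → label (x ∸ k) (y ∸ k)))
    (trans (sym (label-unaltered x y (unaltered-row x y my≤y))) p)))

  column-capped : ∀ x {y₀} Y → my ≤ Y → y₀ ≤ Y → label x y₀ ≡ true →
                  ∀ y → label x y ≡ true → y ≤ Y
  column-capped x Y my≤Y y₀≤Y p₀ y p with y ≤? Y
  ... | yes y≤Y = y≤Y
  ... | no  y≰Y = ⊥-elim (not-¬ (columnBelow-true⁺ x (≤-<-trans y₀≤Y (≰⇒> y≰Y)) p₀)
                                (columnBelow-high-P x y (≤-trans my≤Y (<⇒≤ (≰⇒> y≰Y))) p))

  -- If column x has no P below row Y, then (x , Y) is P: Y is above all P-positions
  -- to its left, also along the diagonal, and row Y is unaltered.
  column-has-P : ∀ x B Y → (∀ c y → c < x → label c y ≡ true → y ≤ B) → my ≤ Y → B + x < Y →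
                 ∃[ y ] (y ≤ Y × label x y ≡ true)
  column-has-P x B Y left my≤Y B+x<Y with columnBelow x Y in below
  ... | true  = let y , y<Y , p = columnBelow-true⁻ x Y below in y , <⇒≤ y<Y , p
  ... | false = Y , ≤-refl , trans (label-unaltered x Y (unaltered-row x Y my≤Y))
                  (cong₂ (λ a b → not (a ∨ b)) rowEmpty (cong₂ _∨_ below diagEmpty))
    where
    rowEmpty : someK x (λ k → label (x ∸ k) Y) ≡ false
    rowEmpty = someK-false x _ λ k 0<k k≤x → ¬-not λ p →
      <⇒≱ (≤-<-trans (m≤m+n B x) B+x<Y) (left _ Y (∸-monoʳ-< 0<k k≤x) p)
    diagEmpty : someK (x ⊓ Y) (λ k → label (x ∸ k) (Y ∸ k)) ≡ false
    diagEmpty = someK-false (x ⊓ Y) _ λ k 0<k k≤x⊓Y → ¬-not λ p →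
      let k≤x = ≤-trans k≤x⊓Y (m⊓n≤m x Y) in
      <⇒≱ (m+n≤o⇒m≤o∸n (suc B) (≤-trans (+-monoʳ-≤ (suc B) k≤x) B+x<Y))
          (left _ _ (∸-monoʳ-< 0<k k≤x) p)

  colBound : ℕ → ℕ
  colBound zero    = suc my
  colBound (suc x) = suc (my + colBound x + suc x)

  my≤colBound : ∀ x → my ≤ colBound x
  my≤colBound zero    = n≤1+n my
  my≤colBound (suc x) = ≤-trans (≤-trans (m≤m+n my (colBound x)) (m≤m+n _ (suc x))) (n≤1+n _)

  colBound-mono : ∀ x → colBound x ≤ colBound (suc x)
  colBound-mono x = ≤-trans (≤-trans (m≤n+m (colBound x) my) (m≤m+n _ (suc x))) (n≤1+n _)

  column-P-exists : ∀ x → ∃[ y ] (y ≤ colBound x × label x y ≡ true)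
  columns-P-bounded : ∀ x c y → c ≤ x → label c y ≡ true → y ≤ colBound x

  column-P-exists zero    = column-has-P 0 0 (suc my) (λ _ _ ()) (n≤1+n my) (s≤s z≤n)
  column-P-exists (suc x) = column-has-P (suc x) (colBound x) (colBound (suc x))
    (λ c y c<1+x → columns-P-bounded x c y (≤-pred c<1+x)) (my≤colBound (suc x))
    (s≤s (+-monoˡ-≤ (suc x) (m≤n+m (colBound x) my)))

  columns-P-bounded x c y c≤x p with m≤n⇒m<n∨m≡n c≤x
  ... | inj₂ refl = let y₀ , y₀≤ , p₀ = column-P-exists x in column-capped x _ (my≤colBound x) y₀≤ p₀ y p
  columns-P-bounded (suc x) c y _ p | inj₁ c<1+x =
    ≤-trans (columns-P-bounded x c y (≤-pred c<1+x) p) (colBound-mono x)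

  -- The row of a P-position of column t + 1 (note the shift); abstract as label is.
  abstract
    pRow : ℕ → ℕ
    pRow t = proj₁ (column-P-exists (suc t))

    label-pRow : ∀ t → label (suc t) (pRow t) ≡ true
    label-pRow t = proj₂ (proj₂ (column-P-exists (suc t)))

  natural-P-options : ∀ t y → mx ≤ suc t → label (suc t) y ≡ true →
                      rowP t y ≡ false × columnBelow (suc t) y ≡ false × diagBelow t y ≡ false
  natural-P-options t y nat p =
    not-∨₃-true⁻ (rowP t y) (columnBelow (suc t) y) (diagBelow t y) (trans (sym (label-natural t y nat)) p)

  natural-P-unique : ∀ t y → mx ≤ suc t → label (suc t) y ≡ true → y ≡ pRow t
  natural-P-unique t y nat p with <-cmp y (pRow t)
  ... | tri≈ _ y≡p _ = y≡p
  ... | tri< y<p _ _ = ⊥-elim (not-¬ (columnBelow-true⁺ (suc t) y<p p)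
                                     (proj₁ (proj₂ (natural-P-options t _ nat (label-pRow t)))))
  ... | tri> _ _ p<y = ⊥-elim (not-¬ (columnBelow-true⁺ (suc t) p<y (label-pRow t))
                                     (proj₁ (proj₂ (natural-P-options t y nat p))))

  rowP-pRow : ∀ t → mx ≤ suc t → rowP t (pRow t) ≡ false
  rowP-pRow t nat = proj₁ (natural-P-options t _ nat (label-pRow t))

  diagBelow-pRow : ∀ t → mx ≤ suc t → diagBelow t (pRow t) ≡ false
  diagBelow-pRow t nat = proj₂ (proj₂ (natural-P-options t _ nat (label-pRow t)))

  below-pRow : ∀ t y → mx ≤ suc t → y < pRow t → rowP t y ≡ true ⊎ diagBelow t y ≡ true
  below-pRow t y nat y<p = ∨-true⁻ (rowP t y) (subst (λ b → rowP t y ∨ b ∨ diagBelow t y ≡ true) noneBelow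
    (not-injective {y = true} (trans (sym (label-natural t y nat)) notP)))
    where
    notP : label (suc t) y ≡ false
    notP = ¬-not λ p → <-irrefl (natural-P-unique t y nat p) y<p
    noneBelow : columnBelow (suc t) y ≡ false
    noneBelow = ¬-not λ e → let y′ , y′<y , p = columnBelow-true⁻ (suc t) y e in
      <-irrefl (natural-P-unique t y′ nat p) (<-trans y′<y y<p)

  pRow-least : ∀ t y → mx ≤ suc t → rowP t y ≡ false → diagBelow t y ≡ false → pRow t ≤ y
  pRow-least t y nat row dia with pRow t ≤? y
  ... | yes p≤y = p≤y
  ... | no  p≰y with below-pRow t y nat (≰⇒> p≰y)
  ...   | inj₁ row′ = ⊥-elim (not-¬ row′ row)
  ...   | inj₂ dia′ = ⊥-elim (not-¬ dia′ dia)

  Extremes : ℕ → ℕ → ℕ → Set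
  Extremes t ℓ u = diag t ℓ ≡ true × diag t u ≡ true × (∀ y → diag t y ≡ true → ℓ ≤ y × y ≤ u)

  RowsFreeAbove : ℕ → ℕ → Set
  RowsFreeAbove t u = ∀ y → rowP t y ≡ true → y ≤ u

  RowsTakenBelow : ℕ → ℕ → Set
  RowsTakenBelow t ℓ = ∀ y → y < ℓ → rowP t y ≡ true

  Regular : ℕ → ℕ → ℕ → Set
  Regular t ℓ u = Extremes t ℓ u × RowsFreeAbove t u × RowsTakenBelow t ℓ

  Gapless : ℕ → ℕ → ℕ → Set
  Gapless t ℓ u = ∀ y → ℓ ≤ y → y ≤ u → diag t y ≡ true

  nextLow : ℕ → ℕ → ℕ
  nextLow t ℓ = suc ℓ ⊓ pRow t

  nextHigh : ℕ → ℕ → ℕ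
  nextHigh t u = suc u ⊔ pRow t

  diag-shift : ∀ t z → diag t z ≡ true → diag (suc t) (suc z) ≡ true
  diag-shift t z d = ∨-trueʳ (label (suc t) (suc z)) d

  diag-pRow : ∀ t → diag (suc t) (pRow t) ≡ true
  diag-pRow t = trans (diag-suc t (pRow t)) (∨-trueˡ _ (label-pRow t))

  diag-suc-true⁻ : ∀ t y → mx ≤ suc t → diag (suc t) y ≡ true →
                   y ≡ pRow t ⊎ ∃[ z ] (y ≡ suc z × diag t z ≡ true)
  diag-suc-true⁻ t y nat d with ∨-true⁻ (label (suc t) y) (trans (sym (diag-suc t y)) d)
  diag-suc-true⁻ t y       nat d | inj₁ p = inj₁ (natural-P-unique t y nat p)
  diag-suc-true⁻ t (suc z) nat d | inj₂ d′ = inj₂ (z , refl , d′)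

  extremes-step : ∀ t ℓ u → mx ≤ suc t → Extremes t ℓ u → Extremes (suc t) (nextLow t ℓ) (nextHigh t u)
  extremes-step t ℓ u nat (dℓ , du , bounds) = dLow , dHigh , bounds′
    where
    dLow : diag (suc t) (nextLow t ℓ) ≡ true
    dLow with ⊓-sel (suc ℓ) (pRow t)
    ... | inj₁ ≡1+ℓ rewrite ≡1+ℓ = diag-shift t ℓ dℓ
    ... | inj₂ ≡p   rewrite ≡p   = diag-pRow t
    dHigh : diag (suc t) (nextHigh t u) ≡ true
    dHigh with ⊔-sel (suc u) (pRow t)
    ... | inj₁ ≡1+u rewrite ≡1+u = diag-shift t u du
    ... | inj₂ ≡p   rewrite ≡p   = diag-pRow t
    bounds′ : ∀ y → diag (suc t) y ≡ true → nextLow t ℓ ≤ y × y ≤ nextHigh t u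
    bounds′ y d with diag-suc-true⁻ t y nat d
    ... | inj₁ refl = m⊓n≤n (suc ℓ) (pRow t) , m≤n⊔m (suc u) (pRow t)
    ... | inj₂ (z , refl , dz) = ≤-trans (m⊓n≤m (suc ℓ) (pRow t)) (s≤s (proj₁ (bounds z dz))) ,
                                ≤-trans (s≤s (proj₂ (bounds z dz))) (m≤m⊔n (suc u) (pRow t))

  rowsFree-step : ∀ t M → mx ≤ suc t → RowsFreeAbove t M → RowsFreeAbove (suc t) (M ⊔ pRow t)
  rowsFree-step t M nat free y r with ∨-true⁻ (label (suc t) y) r
  ... | inj₁ p  rewrite natural-P-unique t y nat p = m≤n⊔m M (pRow t)
  ... | inj₂ r′ = ≤-trans (free y r′) (m≤m⊔n M (pRow t))

  rowsTaken-step : ∀ t ℓ u → mx ≤ suc t → Extremes t ℓ u → RowsTakenBelow (suc t) (nextLow t ℓ)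
  rowsTaken-step t ℓ u nat (_ , _ , bounds) y y<low
    with below-pRow t y nat (<-≤-trans y<low (m⊓n≤n (suc ℓ) (pRow t)))
  ... | inj₁ r = ∨-trueʳ (label (suc t) y) r
  rowsTaken-step t ℓ u nat (_ , _ , bounds) (suc z) y<low | inj₂ dz =
    ⊥-elim (<⇒≱ y<low (≤-trans (m⊓n≤m (suc ℓ) (pRow t)) (s≤s (proj₁ (bounds z dz)))))

  regular-step : ∀ t ℓ u → mx ≤ suc t → Extremes t ℓ u → RowsFreeAbove t u →
                 Regular (suc t) (nextLow t ℓ) (nextHigh t u)
  regular-step t ℓ u nat ext free =
    extremes-step t ℓ u nat ext ,
    (λ y r → ≤-trans (rowsFree-step t u nat free y r) (⊔-monoˡ-≤ (pRow t) (n≤1+n u))) ,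
    rowsTaken-step t ℓ u nat ext

  low≤pRow : ∀ t ℓ u → mx ≤ suc t → Regular t ℓ u → ℓ ≤ pRow t
  low≤pRow t ℓ u nat (_ , _ , taken) = ≮⇒≥ λ p<ℓ → not-¬ (taken _ p<ℓ) (rowP-pRow t nat)

  pRow≤2+high : ∀ t ℓ u → mx ≤ suc t → Regular t ℓ u → pRow t ≤ suc (suc u)
  pRow≤2+high t ℓ u nat ((_ , _ , bounds) , free , _) = pRow-least t _ nat
    (¬-not λ r → 1+n≰n (≤-trans (n≤1+n _) (free _ r)))
    (¬-not λ d → 1+n≰n (proj₂ (bounds (suc u) d)))

  diagBelow-low : ∀ t ℓ u → Extremes t ℓ u → diagBelow t ℓ ≡ false
  diagBelow-low t zero    u _                = refl
  diagBelow-low t (suc z) u (_ , _ , bounds) = ¬-not λ d → 1+n≰n (proj₁ (bounds z d))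

  pRow-free-low : ∀ t ℓ u → mx ≤ suc t → Regular t ℓ u → rowP t ℓ ≡ false → pRow t ≡ ℓ
  pRow-free-low t ℓ u nat reg r =
    ≤-antisym (pRow-least t ℓ nat r (diagBelow-low t ℓ u (proj₁ reg))) (low≤pRow t ℓ u nat reg)

  pRow-taken-low : ∀ t ℓ u → mx ≤ suc t → Regular t ℓ u → rowP t ℓ ≡ true → ℓ < pRow t
  pRow-taken-low t ℓ u nat reg r = ≤∧≢⇒< (low≤pRow t ℓ u nat reg)
    λ { refl → not-¬ r (rowP-pRow t nat) }

  hole-back : ∀ t ℓ u → mx ≤ suc t → Regular t ℓ u → ∀ z → nextLow t ℓ ≤ z → z ≤ nextHigh t u →
              diag (suc t) z ≡ false → ∃[ z₀ ] (z ≡ suc z₀ × ℓ ≤ z₀ × z₀ ≤ u × diag t z₀ ≡ false)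
  hole-back t ℓ u nat reg z lo hi hole =
    predecessor hole (above-⊓ lo (low≤pRow t ℓ u nat reg) z≢p) (below-⊔ hi (pRow≤2+high t ℓ u nat reg) z≢p)
    where
    z≢p : z ≢ pRow t
    z≢p refl = not-¬ (label-pRow t) (∨-conicalˡ _ _ (trans (sym (diag-suc t z)) hole))
    predecessor : ∀ {z} → diag (suc t) z ≡ false → ℓ < z → z ≤ suc u →
                  ∃[ z₀ ] (z ≡ suc z₀ × ℓ ≤ z₀ × z₀ ≤ u × diag t z₀ ≡ false)
    predecessor {suc z₀} hole′ (s≤s ℓ≤z₀) (s≤s z₀≤u) =
      z₀ , refl , ℓ≤z₀ , z₀≤u , ∨-conicalʳ (label (suc t) (suc z₀)) _ hole′

  gapless-step : ∀ t ℓ u → mx ≤ suc t → Regular t ℓ u → Gapless t ℓ u →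
                 Gapless (suc t) (nextLow t ℓ) (nextHigh t u)
  gapless-step t ℓ u nat reg gapless y lo hi with diag (suc t) y in d
  ... | true  = refl
  ... | false = let z₀ , _ , ℓ≤z₀ , z₀≤u , hole = hole-back t ℓ u nat reg y lo hi d in
                ⊥-elim (not-¬ (gapless z₀ ℓ≤z₀ z₀≤u) hole)

  saturated : ∀ t ℓ u → Extremes t ℓ u → Gapless t ℓ u → Saturated G t
  saturated t ℓ u (dℓ , du , bounds) gapless =
    ℓ , u , (from dℓ , λ y D → proj₁ (bounds y (to D))) , (from du , λ y D → proj₂ (bounds y (to D))) ,
    λ y → mk⇔ (λ D → bounds y (to D)) (λ (ℓ≤y , y≤u) → from (gapless y ℓ≤y y≤u))
    where
    to : ∀ {y} → Diag G t y → diag t y ≡ true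
    to = Equivalence.to (Diag⇔diag t _)
    from : ∀ {y} → diag t y ≡ true → Diag G t y
    from = Equivalence.from (Diag⇔diag t _)

  gapless-propagates : ∀ t ℓ u → mx ≤ t → Regular t ℓ u → Gapless t ℓ u →
                       ∀ d → ∃[ ℓ′ ] ∃[ u′ ] (Regular (d + t) ℓ′ u′ × Gapless (d + t) ℓ′ u′)
  gapless-propagates t ℓ u nat reg gapless zero = ℓ , u , reg , gapless
  gapless-propagates t ℓ u nat reg gapless (suc d) with gapless-propagates t ℓ u nat reg gapless d
  ... | ℓ′ , u′ , reg′@(ext′ , free′ , _) , gapless′ =
    _ , _ , regular-step (d + t) ℓ′ u′ nat′ ext′ free′ , gapless-step (d + t) ℓ′ u′ nat′ reg′ gapless′
    where nat′ = ≤-trans nat (≤-trans (m≤n+m t d) (n≤1+n _))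

  saturated-from : ∀ t ℓ u → mx ≤ t → Regular t ℓ u → Gapless t ℓ u → ∀ t′ → t ≤ t′ → Saturated G t′
  saturated-from t ℓ u nat reg gapless t′ t≤t′
    with gapless-propagates t ℓ u nat reg gapless (t′ ∸ t)
  ... | ℓ′ , u′ , (ext′ , _) , gapless′ =
    subst (Saturated G) (m∸n+n≡m t≤t′) (saturated _ ℓ′ u′ ext′ gapless′)

  diag-bounded : ∀ t y → diag t y ≡ true → y ≤ colBound t + t
  diag-bounded t y d = let k , k≤t⊓y , p = anyUpTo-true⁻ (t ⊓ y) _ d in
    ≤-trans (m≤n+m∸n y k) (subst (_≤ colBound t + t) (+-comm (y ∸ k) k)
      (+-mono-≤ (columns-P-bounded t (t ∸ k) (y ∸ k) (m∸n≤m t k) p) (≤-trans k≤t⊓y (m⊓n≤m t y))))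

  extremes-exist : ∀ t → ∃[ ℓ ] ∃[ u ] Extremes t ℓ u
  extremes-exist t with column-P-exists t
  ... | y , _ , p with least diag? bound witness | greatest diag? bound witness (diag-bounded t)
    where
    diag? = λ y → diag t y ≟ᵇ true
    bound = colBound t + t
    d : diag t y ≡ true
    d = anyUpTo-true⁺ (t ⊓ y) _ z≤n p
    witness = y , diag-bounded t y d , d
  ... | ℓ , dℓ , ℓ-least | u , du , u-greatest = ℓ , u , dℓ , du , λ z dz → ℓ-least z dz , u-greatest z dz

  rowsFree-exists : ∀ n t ℓ u M → mx ≤ t → Extremes t ℓ u → RowsFreeAbove t M → M ∸ u ≤ n →
                    ∃[ t′ ] ∃[ ℓ′ ] ∃[ u′ ] (mx ≤ t′ × Extremes t′ ℓ′ u′ × RowsFreeAbove t′ u′)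
  rowsFree-exists zero t ℓ u M nat ext free M∸u≤0 =
    t , ℓ , u , nat , ext , λ y r → ≤-trans (free y r) (m∸n≡0⇒m≤n (n≤0⇒n≡0 M∸u≤0))
  rowsFree-exists (suc n) t ℓ u M nat ext free M∸u≤1+n =
    rowsFree-exists n (suc t) _ _ _ nat′ (extremes-step t ℓ u nat′ ext) (rowsFree-step t M nat′ free) gap
    where
    nat′ = ≤-trans nat (n≤1+n t)
    gap : (M ⊔ pRow t) ∸ nextHigh t u ≤ n
    gap with ⊔-sel M (pRow t)
    ... | inj₁ ≡M rewrite ≡M = ≤-trans (∸-monoʳ-≤ M (m≤m⊔n (suc u) (pRow t)))
                                 (subst (_≤ n) (pred[m∸n]≡m∸[1+n] M u) (pred-mono-≤ M∸u≤1+n))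
    ... | inj₂ ≡p rewrite ≡p = ≤-trans (≤-reflexive (m≤n⇒m∸n≡0 (m≤n⊔m (suc u) (pRow t)))) z≤n

  regular-exists : ∃[ t ] ∃[ ℓ ] ∃[ u ] (mx ≤ t × Regular t ℓ u)
  regular-exists with extremes-exist mx
  ... | ℓ₀ , u₀ , ext₀
    with rowsFree-exists (colBound mx ∸ u₀) mx ℓ₀ u₀ (colBound mx) ≤-refl ext₀
           (λ y r → let c , c≤mx , p = rowP-true⁻ mx y r in columns-P-bounded mx c y c≤mx p) ≤-refl
  ... | t , ℓ , u , nat , ext , free =
    suc t , _ , _ , ≤-trans nat (n≤1+n t) , regular-step t ℓ u (≤-trans nat (n≤1+n t)) ext free

  module Trajectory (T : ℕ) (natT : mx ≤ T) (ℓ₀ u₀ : ℕ) (reg₀ : Regular T ℓ₀ u₀) where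

    low : ℕ → ℕ
    low zero    = ℓ₀
    low (suc j) = nextLow (j + T) (low j)

    high : ℕ → ℕ
    high zero    = u₀
    high (suc j) = nextHigh (j + T) (high j)

    p : ℕ → ℕ
    p j = pRow (j + T)

    nat : ∀ j → mx ≤ suc (j + T)
    nat j = ≤-trans natT (≤-trans (m≤n+m T j) (n≤1+n _))

    regular : ∀ j → Regular (j + T) (low j) (high j)
    regular zero    = reg₀
    regular (suc j) = regular-step (j + T) (low j) (high j) (nat j) (proj₁ (regular j)) (proj₁ (proj₂ (regular j)))

    Taken : ℕ → Set
    Taken j = rowP (j + T) (low j) ≡ true

    -- Then p j − 1 is a hole of column j + T between low j and high j, filled in column j + T + 1.
    Fills : ℕ → Set
    Fills j = Taken j × p j ≤ suc (high j)

    p-free : ∀ j → rowP (j + T) (low j) ≡ false → p j ≡ low j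
    p-free j = pRow-free-low (j + T) (low j) (high j) (nat j) (regular j)

    p-taken : ∀ j → Taken j → low j < p j
    p-taken j = pRow-taken-low (j + T) (low j) (high j) (nat j) (regular j)

    p≤2+high : ∀ j → p j ≤ suc (suc (high j))
    p≤2+high j = pRow≤2+high (j + T) (low j) (high j) (nat j) (regular j)

    taken-next : ∀ j → ¬ Taken j → Taken (suc j)
    taken-next j free = subst (λ ℓ → rowP (suc (j + T)) ℓ ≡ true) (sym low-stays)
      (∨-trueˡ _ (subst (λ y → label (suc (j + T)) y ≡ true) (p-free j (¬-not free)) (label-pRow (j + T))))
      where
      low-stays : low (suc j) ≡ low j
      low-stays = trans (cong (suc (low j) ⊓_) (p-free j (¬-not free))) (m≥n⇒m⊓n≡n (n≤1+n _))

    high-grows : ∀ i d → d + high i ≤ high (d + i)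
    high-grows i zero    = ≤-refl
    high-grows i (suc d) = ≤-trans (s≤s (high-grows i d)) (m≤m⊔n _ (p (d + i)))

    high-mono : ∀ {i j} → i ≤ j → high i ≤ high j
    high-mono {i} {j} i≤j = subst (λ k → high i ≤ high k) (m∸n+n≡m i≤j)
      (≤-trans (m≤n+m (high i) (j ∸ i)) (high-grows i (j ∸ i)))

    p≤high : ∀ j → p j ≤ high (suc j)
    p≤high j = m≤n⊔m (suc (high j)) (p j)

    row-source : ∀ j y → u₀ < y → rowP (j + T) y ≡ true → ∃[ i ] (i < j × p i ≡ y)
    row-source zero    y u₀<y r = ⊥-elim (<⇒≱ u₀<y (proj₁ (proj₂ reg₀) y r))
    row-source (suc j) y u₀<y r with ∨-true⁻ (label (suc (j + T)) y) r
    ... | inj₁ P  = j , n<1+n j , sym (natural-P-unique (j + T) y (nat j) P)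
    ... | inj₂ r′ = let i , i<j , pi = row-source j y u₀<y r′ in i , m<n⇒m<1+n i<j , pi

    module FromHole (h₀ : ℕ) (ℓ₀≤h₀ : ℓ₀ ≤ h₀) (h₀≤u₀ : h₀ ≤ u₀) (hole₀ : diag T h₀ ≡ false) where

      a₀ : ℕ
      a₀ = u₀ ∸ h₀

      u₀≤a₀+h₀ : u₀ ≤ a₀ + h₀
      u₀≤a₀+h₀ = subst (u₀ ≤_) (+-comm h₀ a₀) (m≤n+m∸n u₀ h₀)

      N : ℕ
      N = suc (suc (suc (high a₀ + a₀)))

      -- a₀ is where the hole diagonal j + h₀ reaches u₀.  Without a Fill the hole persists and a
      -- Taken column j has p j = high j + 2; beyond a₀ a row just above the hole diagonal can only be
      -- taken by such an earlier p, which rules out Taken at two consecutive indices, while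
      -- taken-next rules out two consecutive non-Taken ones.
      module NoFill (nofill : ∀ j → j ≤ N → Taken j → p j ≡ suc (suc (high j))) where

        hole-persists : ∀ j → j ≤ N → low j ≤ j + h₀ × j + h₀ ≤ high j × diag (j + T) (j + h₀) ≡ false
        hole-persists zero    _     = ℓ₀≤h₀ , h₀≤u₀ , hole₀
        hole-persists (suc j) 1+j≤N with hole-persists j (≤-trans (n≤1+n j) 1+j≤N)
        ... | lo , hi , hole =
          ≤-trans (m⊓n≤m (suc (low j)) (p j)) (s≤s lo) , ≤-trans (s≤s hi) (m≤m⊔n _ (p j)) ,
          cong₂ _∨_ (¬-not λ P → p-avoids (rowP (j + T) (low j)) refl (natural-P-unique (j + T) _ (nat j) P))
                    hole
          where
          p-avoids : ∀ b → rowP (j + T) (low j) ≡ b → suc (j + h₀) ≢ p j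
          p-avoids false r h≡p = 1+n≰n (≤-trans (≤-reflexive (trans h≡p (p-free j r))) lo)
          p-avoids true  r h≡p =
            1+n≰n (≤-trans (≤-reflexive (sym (suc-injective (trans h≡p (nofill j (≤-trans (n≤1+n j) 1+j≤N) r))))) hi)

        taken-above-hole : ∀ j → j ≤ N → Taken j → rowP (j + T) (suc (j + h₀)) ≡ true
        taken-above-hole j j≤N tj = ¬-not λ r →
          let lo , hi , hole = hole-persists j j≤N in
          1+n≰n (≤-trans (≤-pred (subst (_≤ suc (j + h₀)) (nofill j j≤N tj)
                                   (pRow-least (j + T) _ (nat j) r hole))) hi)

        taken-if-above : ∀ j → j ≤ N → j + h₀ < p j → Taken j
        taken-if-above j j≤N h<p = ¬-not λ r →
          <⇒≱ h<p (subst (_≤ j + h₀) (sym (p-free j r)) (proj₁ (hole-persists j j≤N)))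

        p-taken-high : ∀ j → j ≤ N → Taken j → p j ≡ high (suc j)
        p-taken-high j j≤N tj =
          sym (m≤n⇒m⊔n≡n (subst (suc (high j) ≤_) (sym (nofill j j≤N tj)) (n≤1+n _)))

        taken-apart : ∀ i j → i < j → j ≤ N → Taken i → Taken j → suc (suc (p i)) ≤ p j
        taken-apart i j i<j j≤N ti tj = subst (suc (suc (p i)) ≤_) (sym (nofill j j≤N tj))
          (s≤s (s≤s (subst (_≤ high j) (sym (p-taken-high i (≤-trans (<⇒≤ i<j) j≤N) ti)) (high-mono i<j))))

        taken-far-apart : ∀ i j → suc (suc i) ≤ j → j ≤ N → Taken j → suc (suc (suc (p i))) ≤ p j
        taken-far-apart i j 2+i≤j j≤N tj = subst (suc (suc (suc (p i))) ≤_) (sym (nofill j j≤N tj))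
          (s≤s (s≤s (≤-trans (s≤s (p≤high i)) (≤-trans (m≤m⊔n _ (p (suc i))) (high-mono 2+i≤j)))))

        taken-not-adjacent : ∀ i j → i ≤ N → j ≤ N → Taken i → Taken j → p j ≢ suc (p i)
        taken-not-adjacent i j i≤N j≤N ti tj pj≡ with <-cmp i j
        ... | tri< i<j _ _ = 1+n≰n (≤-trans (taken-apart i j i<j j≤N ti tj) (≤-reflexive pj≡))
        ... | tri≈ _ refl _ = 1+n≰n (≤-reflexive (sym pj≡))
        ... | tri> _ _ j<i = 1+n≰n (≤-trans (s≤s (≤-trans (n≤1+n _) (≤-reflexive (sym pj≡))))
                                            (≤-trans (n≤1+n _) (taken-apart j i j<i i≤N tj ti)))

        source-above-hole : ∀ j → j ≤ N → u₀ ≤ j + h₀ → Taken j →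
                            ∃[ i ] (i < j × Taken i × p i ≡ suc (j + h₀))
        source-above-hole j j≤N u₀≤ tj =
          let i , i<j , pi = row-source j _ (s≤s u₀≤) (taken-above-hole j j≤N tj) in
          i , i<j , taken-if-above i (≤-trans (<⇒≤ i<j) j≤N)
                      (subst (i + h₀ <_) (sym pi) (s≤s (+-monoˡ-≤ h₀ (<⇒≤ i<j)))) , pi

        no-consecutive : ∀ j → suc j ≤ N → u₀ ≤ j + h₀ → Taken j → ¬ Taken (suc j)
        no-consecutive j 1+j≤N u₀≤ tj tj′ =
          let i  , i<j  , ti  , pi  = source-above-hole j (≤-trans (n≤1+n j) 1+j≤N) u₀≤ tj
              i′ , i′<j , ti′ , pi′ = source-above-hole (suc j) 1+j≤N (≤-trans u₀≤ (n≤1+n _)) tj′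
          in taken-not-adjacent i i′ (≤-trans (<⇒≤ i<j) (≤-trans (n≤1+n j) 1+j≤N))
               (≤-trans (<⇒≤ i′<j) 1+j≤N) ti ti′ (trans pi′ (cong suc (sym pi)))

        two-apart-consecutive : ∀ i j → i ≤ N → j ≤ N → Taken i → Taken j →
                                p j ≡ suc (suc (p i)) → j ≡ suc i
        two-apart-consecutive i j i≤N j≤N ti tj pj≡ with <-cmp i j
        ... | tri≈ _ refl _ = ⊥-elim (1+n≰n (≤-trans (n≤1+n _) (≤-reflexive (sym pj≡))))
        ... | tri> _ _ j<i = ⊥-elim (<⇒≱ (subst (suc (p i) ≤_) (sym pj≡) (n≤1+n _))
                                        (≤-trans (n≤1+n _) (≤-trans (n≤1+n _) (taken-apart j i j<i i≤N tj ti))))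
        ... | tri< i<j _ _ with m≤n⇒m<n∨m≡n i<j
        ...   | inj₂ 1+i≡j = sym 1+i≡j
        ...   | inj₁ 1+i<j = ⊥-elim (1+n≰n (≤-trans (taken-far-apart i j 1+i<j j≤N tj) (≤-reflexive pj≡)))

        source-late : ∀ i b → i ≤ N → Taken i → high a₀ ≤ b → p i ≡ suc (b + h₀) → a₀ ≤ i
        source-late i b i≤N ti high≤b pi≡ = ≮⇒≥ λ i<a₀ →
          1+n≰n (≤-trans (≤-reflexive (sym pi≡)) (≤-trans (≤-reflexive (p-taken-high i i≤N ti))
            (≤-trans (high-mono i<a₀) (≤-trans high≤b (m≤m+n b h₀)))))

        late-taken-impossible : ∀ b → suc (suc b) ≤ N → a₀ ≤ b → high a₀ ≤ b → Taken b → ⊥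
        late-taken-impossible b 2+b≤N a₀≤b high≤b tb =
          impossible (source-above-hole b b≤N u₀≤b+h₀ tb)
            (source-above-hole (suc (suc b)) 2+b≤N (≤-trans u₀≤b+h₀ (≤-trans (n≤1+n _) (n≤1+n _)))
              (taken-next (suc b) (no-consecutive b (≤-trans (n≤1+n _) 2+b≤N) u₀≤b+h₀ tb)))
          where
          b≤N : b ≤ N
          b≤N = ≤-trans (n≤1+n b) (≤-trans (n≤1+n _) 2+b≤N)
          u₀≤b+h₀ : u₀ ≤ b + h₀
          u₀≤b+h₀ = ≤-trans u₀≤a₀+h₀ (+-monoˡ-≤ h₀ a₀≤b)
          impossible : ∃[ i ] (i < b × Taken i × p i ≡ suc (b + h₀)) →
                       ∃[ i′ ] (i′ < suc (suc b) × Taken i′ × p i′ ≡ suc (suc (suc b) + h₀)) → ⊥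
          impossible (i , i<b , ti , pi) (i′ , i′<2+b , ti′ , pi′)
            with two-apart-consecutive i i′ (≤-trans (<⇒≤ i<b) b≤N) (≤-trans (<⇒≤ i′<2+b) 2+b≤N) ti ti′
                   (trans pi′ (cong (λ y → suc (suc y)) (sym pi)))
          ... | refl = no-consecutive i (≤-trans (<⇒≤ i′<2+b) 2+b≤N)
                         (≤-trans u₀≤a₀+h₀ (+-monoˡ-≤ h₀ (source-late i b (≤-trans (<⇒≤ i<b) b≤N) ti high≤b pi)))
                         ti ti′

      fill-exists : ∃[ j ] Fills j
      fill-exists with search≤ (λ j → (rowP (j + T) (low j) ≟ᵇ true) ×-dec (p j ≤? suc (high j))) N
      ... | inj₁ (j , _ , fills) = j , fills
      ... | inj₂ none = ⊥-elim (late (rowP (b₀ + T) (low b₀)) refl)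
        where
        nofill : ∀ j → j ≤ N → Taken j → p j ≡ suc (suc (high j))
        nofill j j≤N tj = ≤-antisym (p≤2+high j) (≰⇒> λ p≤ → none j j≤N (tj , p≤))
        open NoFill nofill
        b₀ = high a₀ + a₀
        late : ∀ b → rowP (b₀ + T) (low b₀) ≡ b → ⊥
        late true  r = late-taken-impossible b₀ (n≤1+n _) (m≤n+m a₀ _) (m≤m+n _ a₀) r
        late false r = late-taken-impossible (suc b₀) ≤-refl (≤-trans (m≤n+m a₀ _) (n≤1+n _))
                         (≤-trans (m≤m+n _ a₀) (n≤1+n _)) (taken-next b₀ λ tb → not-¬ tb r)

  -- Every hole of column i + t₁ between low i and high i continues the diagonal of a hole
  -- of column t₁ (hole-origin), so it is counted by holes i.
  module HoleCount (t₁ : ℕ) (nat₁ : mx ≤ t₁) (ℓ₁ u₁ : ℕ) (reg₁ : Regular t₁ ℓ₁ u₁) where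

    open Trajectory t₁ nat₁ ℓ₁ u₁ reg₁

    width : ℕ
    width = suc (u₁ ∸ ℓ₁)

    holeAt : ℕ → ℕ → ℕ
    holeAt i k = if diag (i + t₁) (i + (ℓ₁ + k)) then 0 else 1

    holes : ℕ → ℕ
    holes i = sumBelow width (holeAt i)

    holeAt-antitone : ∀ i k → holeAt (suc i) k ≤ holeAt i k
    holeAt-antitone i k with diag (i + t₁) (i + (ℓ₁ + k))
    ... | true  = ≤-reflexive (cong (λ b → if b then 0 else 1) (∨-zeroʳ (label (suc (i + t₁)) _)))
    ... | false = bound (label (suc (i + t₁)) (suc (i + (ℓ₁ + k))) ∨ false)
      where
      bound : ∀ b → (if b then 0 else 1) ≤ 1
      bound true  = z≤n
      bound false = ≤-refl

    holes-antitone : ∀ {i i′} → i ≤ i′ → holes i′ ≤ holes i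
    holes-antitone {i} {i′} i≤i′ = subst (λ j → holes j ≤ holes i) (m∸n+n≡m i≤i′) (go (i′ ∸ i))
      where
      go : ∀ d → holes (d + i) ≤ holes i
      go zero    = ≤-refl
      go (suc d) = ≤-trans (sumBelow-mono width _ _ λ k _ → holeAt-antitone (d + i) k) (go d)

    hole-origin : ∀ i y → low i ≤ y → y ≤ high i → diag (i + t₁) y ≡ false →
                  ∃[ k ] (k < width × y ≡ i + (ℓ₁ + k))
    hole-origin zero y ℓ₁≤y y≤u₁ _ = y ∸ ℓ₁ , s≤s (∸-monoˡ-≤ ℓ₁ y≤u₁) , sym (m+[n∸m]≡n ℓ₁≤y)
    hole-origin (suc i) y lo hi hole
      with hole-back (i + t₁) (low i) (high i) (nat i) (regular i) y lo hi hole
    ... | z₀ , refl , lo′ , hi′ , hole′ with hole-origin i z₀ lo′ hi′ hole′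
    ...   | k , k<width , refl = k , k<width , refl

    holes-drop : ∀ i → Fills i → holes (suc i) < holes i
    holes-drop i (ti , p≤) = filled (p i) refl (p-taken i ti) p≤
      where
      filled : ∀ y → p i ≡ y → low i < y → y ≤ suc (high i) → holes (suc i) < holes i
      filled (suc z) p≡ (s≤s lo) (s≤s hi)
        with hole-origin i z lo hi (subst (λ y → diagBelow (i + t₁) y ≡ false) p≡ (diagBelow-pRow (i + t₁) (nat i)))
      ... | k , k<width , refl = sumBelow-mono-< width _ _ (λ k _ → holeAt-antitone i k) k k<width
        (subst₂ _<_ (sym filledNow) (sym holeBefore) (s≤s z≤n))
        where
        holeBefore : holeAt i k ≡ 1
        holeBefore = cong (λ b → if b then 0 else 1)
          (subst (λ y → diagBelow (i + t₁) y ≡ false) p≡ (diagBelow-pRow (i + t₁) (nat i)))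
        filledNow : holeAt (suc i) k ≡ 0
        filledNow = cong (λ b → if b then 0 else 1)
          (subst (λ y → diag (suc (i + t₁)) y ≡ true) p≡ (diag-pRow (i + t₁)))

    hole-or-gapless : ∀ i → ∃[ y ] (y ≤ high i × low i ≤ y × diag (i + t₁) y ≡ false)
                            ⊎ Gapless (i + t₁) (low i) (high i)
    hole-or-gapless i with search≤ (λ y → (low i ≤? y) ×-dec (diag (i + t₁) y ≟ᵇ false)) (high i)
    ... | inj₁ hole = inj₁ hole
    ... | inj₂ none = inj₂ λ y lo hi → ¬-not λ d → none y hi (lo , d)

    module Shifted (i : ℕ) = Trajectory (i + t₁) (≤-trans nat₁ (m≤n+m t₁ i)) (low i) (high i) (regular i)

    shifted : ∀ i j → Shifted.low i j ≡ low (j + i) × Shifted.high i j ≡ high (j + i)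
    shifted i zero    = refl , refl
    shifted i (suc j) with shifted i j
    ... | low≡ , high≡ rewrite +-assoc j i t₁ | low≡ | high≡ = refl , refl

    fill-after : ∀ i y → low i ≤ y → y ≤ high i → diag (i + t₁) y ≡ false → ∃[ i′ ] (i ≤ i′ × Fills i′)
    fill-after i y lo hi hole with Shifted.FromHole.fill-exists i y lo hi hole
    ... | j , taken , p≤ with shifted i j
    ...   | low≡ , high≡ = j + i , m≤n+m i j ,
      subst₂ (λ c ℓ → rowP c ℓ ≡ true) (sym (+-assoc j i t₁)) low≡ taken ,
      subst₂ (λ c u → pRow c ≤ suc u) (sym (+-assoc j i t₁)) high≡ p≤

    gapless-eventually : ∀ c i → holes i ≤ c → ∃[ i′ ] Gapless (i′ + t₁) (low i′) (high i′)
    gapless-eventually c i holes≤c with hole-or-gapless i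
    ... | inj₂ gapless = i , gapless
    ... | inj₁ (y , hi , lo , hole) with fill-after i y lo hi hole
    ...   | i′ , i≤i′ , fills = recurse c (≤-trans (holes-drop i′ fills) (≤-trans (holes-antitone i≤i′) holes≤c))
      where
      recurse : ∀ c → suc (holes (suc i′)) ≤ c → ∃[ i′ ] Gapless (i′ + t₁) (low i′) (high i′)
      recurse (suc c) h = gapless-eventually c (suc i′) (≤-pred h)

lemma2 : (G : AlteredWythoff) (mx : ℕ) → BoundsColumns G mx →
         ∃[ t ] (mx ≤ t × (∀ t′ → t ≤ t′ → Saturated G t′))
lemma2 G mx bounds =
  let t₁ , ℓ₁ , u₁ , nat₁ , reg₁ = regular-exists
      i , gapless = HoleCount.gapless-eventually t₁ nat₁ ℓ₁ u₁ reg₁ _ 0 ≤-refl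
      nat = ≤-trans nat₁ (m≤n+m t₁ i)
  in i + t₁ , nat , saturated-from (i + t₁) _ _ nat (Trajectory.regular t₁ nat₁ ℓ₁ u₁ reg₁ i) gapless
  where open Positions G mx bounds
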